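{- Let $G$ be an Eulerian directed multigraph with $n$ vertices and $m$ edges, given (read-only) with fixed orderings of incoming and outgoing edges at each vertex. Algorithm \textsc{Space-Efficient-Hierholzer} (described in the context) uses $\mathrm{O}(n\lg m)$ bits of working space, i.e. auxiliary memory excluding the read-only input and the write-only output.
   Context: $G=(V,E)$ is a finite directed multigraph (loops and parallel edges allowed), $V=[n]$, $|E|=m$. $d^+(v)$, $d^-(v)$ are out- and in-degree. $G$ is Eulerian: strongly connected and $d^+(v)=d^-(v)$ for all $v$. $\Gamma^+(v,i)$ is the head of the $i$-th outgoing edge of $v$ and $\Gamma^-(v,i)$ the tail of the $i$-th incoming edge of $v$, w.r.t. arbitrary fixed orderings. Algorithm \textsc{Space-Efficient-Hierholzer}: initialise integer arrays $\texttt{next}[1..n]$, $B[1..n]$ and bit arrays $\texttt{visited}[1..n]$, $\texttt{skipped}[1..n]$ to all zeros and a counter $c\gets 0$. Pick an arbitrary $v_0\in[n]$, set $u\gets v_0$ and $\texttt{visited}[u]\gets 1$. While $c<m$: set $\texttt{next}[u]\gets\texttt{next}[u]+1$ and $i\gets\texttt{next}[u]$. If $i\le d^-(u)$: let $v\gets\Gamma^-(u,i)$; if $\texttt{visited}[v]=0$ then (if $v\ne v_0$ set $B[v]\gets u$) and set $\texttt{visited}[v]\gets 1$; then set $u\gets v$. Otherwise: set $i\gets \texttt{next}[u]-d^-(u)$; if $\Gamma^+(u,i)=B[u]$ and $\texttt{skipped}[u]=0$, then set $\texttt{skipped}[u]\gets 1$, $\texttt{next}[u]\gets\texttt{next}[u]+1$,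 $i\gets i+1$ (the test is taken to be false if $i>d^+(u)$). Then if $i>d^+(u)$ let $v\gets B[u]$, else $v\gets \Gamma^+(u,i)$; write the edge $uv$ to the output, set $c\gets c+1$ and $u\gets v$. -}

module Defs where

open import Data.Nat using (ℕ; zero; suc; _+_; _*_; _∸_; _≤_; _<_; _≤?_; _<?_)
open import Data.Nat.Logarithm using (⌈log₂_⌉; ⌊log₂_⌋)
open import Data.Fin using (Fin; toℕ; fromℕ<)
import Data.Fin as F
open import Data.Bool using (Bool; true; false; if_then_else_)
open import Data.List using (List; []; _∷_; length; map; allFin; foldr)
open import Data.Nat.ListAction using (sum)
open import Data.List.Membership.Propositional using (_∈_)
open import Data.Maybe using (Maybe; just; nothing)
open import Data.Product using (_×_; _,_)
open import Relation.Nullary using (yes; no; does)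
open import Relation.Binary.PropositionalEquality using (_≡_)
import Data.Nat as N

-- Directed multigraphs on vertex set Fin n (the paper's [n]) with fixed
-- orderings of outgoing and incoming edges at each vertex.
--   outs v = [Γ⁺(v,1), …, Γ⁺(v,d⁺(v))]   (heads of out-edges, in order)
--   ins  v = [Γ⁻(v,1), …, Γ⁻(v,d⁻(v))]   (tails of in-edges, in order)
-- Consistency: the number of u→v edges seen from u equals the number seen
-- from v (both lists describe the same edge multiset).

occ : ∀ {n} → Fin n → List (Fin n) → ℕ
occ v [] = 0
occ v (w ∷ ws) = if does (w F.≟ v) then suc (occ v ws) else occ v ws

record Graph (n : ℕ) : Set where
  field
    outs : Fin n → List (Fin n)
    ins  : Fin n → List (Fin n)
    consistent : ∀ u v → occ v (outs u) ≡ occ u (ins v)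

module _ {n : ℕ} (G : Graph n) where
  open Graph G

  outdeg indeg : Fin n → ℕ
  outdeg v = length (outs v)
  indeg  v = length (ins v)

  edges : ℕ
  edges = sum (map outdeg (allFin n))

  data Reach : Fin n → Fin n → Set where
    here : ∀ {u} → Reach u u
    there : ∀ {u w v} → w ∈ outs u → Reach w v → Reach u v

  StronglyConnected : Set
  StronglyConnected = ∀ u v → Reach u v

  Eulerian : Set
  Eulerian = StronglyConnected × (∀ v → outdeg v ≡ indeg v)

-- Algorithm Space-Efficient-Hierholzer as a state machine.
-- Vertices are Fin n; the array B stores natural numbers, where 0 means
-- "unset" (initial value) and suc (toℕ u) encodes vertex u.

-- 1-based list lookup
nth : {A : Set} → List A → ℕ → Maybe A
nth [] _ = nothing
nth (x ∷ xs) zero = nothing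
nth (x ∷ xs) (suc zero) = just x
nth (x ∷ xs) (suc (suc i)) = nth xs (suc i)

upd : ∀ {n} {A : Set} → (Fin n → A) → Fin n → A → (Fin n → A)
upd f v x w = if does (w F.≟ v) then x else f w

encV : ∀ {n} → Fin n → ℕ
encV u = suc (toℕ u)

decV : ∀ {n} → ℕ → Maybe (Fin n)
decV zero = nothing
decV {n} (suc k) with k <? n
... | yes p = just (fromℕ< p)
... | no _  = nothing

record State (n : ℕ) : Set where
  field
    next    : Fin n → ℕ
    B       : Fin n → ℕ
    visited : Fin n → Bool
    skipped : Fin n → Bool
    c       : ℕ
    cur     : Fin n
    v₀      : Fin n

initState : ∀ {n} → Fin n → State n
initState v0 = record
  { next = λ _ → 0 ; B = λ _ → 0
  ; visited = upd (λ _ → false) v0 true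
  ; skipped = λ _ → false ; c = 0 ; cur = v0 ; v₀ = v0 }

module _ {n : ℕ} (G : Graph n) where
  open Graph G

  -- one iteration of the while-loop body (ignoring the write-only output);
  -- `nothing` if the body would access an undefined entry.
  step : State n → Maybe (State n)
  step s = body
    where
    open State s
    u = cur
    nx = suc (next u)
    next₁ = upd next u nx
    moveOut : ℕ → (Fin n → ℕ) → (Fin n → Bool) → Maybe (State n)
    moveOut i nxt skp with outdeg G u N.<? i
    ... | yes _ with decV {n} (B u)
    ...   | nothing = nothing
    ...   | just v = just (record s { next = nxt ; skipped = skp ; c = suc c ; cur = v })
    moveOut i nxt skp | no _ with nth (outs u) i
    ...   | nothing = nothing
    ...   | just v = just (record s { next = nxt ; skipped = skp ; c = suc c ; cur = v })
    body : Maybe (State n)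
    body with nx ≤? indeg G u
    ... | yes _ with nth (ins u) nx
    ...   | nothing = nothing
    ...   | just v with visited v
    ...     | true = just (record s { next = next₁ ; cur = v })
    ...     | false = just (record s
                { next = next₁
                ; B = if does (v F.≟ v₀) then B else upd B v (encV u)
                ; visited = upd visited v true
                ; cur = v })
    body | no _ with nth (outs u) (nx ∸ indeg G u)
    ... | just w with does (encV w N.≟ B u) | skipped u
    ...   | true | false = moveOut (suc (nx ∸ indeg G u)) (upd next u (suc nx)) (upd skipped u true)
    ...   | _ | _ = moveOut (nx ∸ indeg G u) next₁ skipped
    body | no _ | nothing = moveOut (nx ∸ indeg G u) next₁ skipped

  run : Fin n → ℕ → Maybe (State n)
  run v0 zero = just (initState v0)
  run v0 (suc k) with run v0 k
  ... | nothing = nothing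
  ... | just s with State.c s N.<? edges G
  ...   | yes _ = step s
  ...   | no _ = just s

-- Working space in bits.  Each integer array is stored with fixed-width
-- cells wide enough for its largest entry; bit arrays use 1 bit per cell;
-- scalars use their binary length.

bitlen : ℕ → ℕ
bitlen x = ⌈log₂ (suc x) ⌉

maxOver : ∀ {n} → (Fin n → ℕ) → ℕ
maxOver {n} f = foldr N._⊔_ 0 (map f (allFin n))

workSpace : ∀ {n} → State n → ℕ
workSpace {n} s =
    n * bitlen (maxOver next) + n * bitlen (maxOver B) + n + n
  + bitlen c + bitlen (encV cur) + bitlen (encV v₀)
  where open State s

{-# OPTIONS --safe #-}
module Submission where

-- Every integer the algorithm stores is polynomial in m.  The array B holds
-- vertex codes (at most n), the counter c never exceeds m, and each loop
-- iteration at u either reads an incoming edge (so next[u] ≤ d⁻(u)) or outputs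
-- an edge, which raises c by one and next[u] by at most two (the skip); hence
-- next[u] ≤ 2c + d⁻(u) ≤ 3m.  Strong connectivity gives every vertex an
-- outgoing edge once n ≥ 2, so n ≤ m, and every cell fits in O(lg m) bits.

open import Defs
open import Data.Nat
  using (ℕ; zero; suc; _+_; _*_; _∸_; _^_; _≤_; _<_; _≤?_; _<?_; _≟_; _⊔_; z≤n; s≤s; ⌊_/2⌋)
open import Data.Nat.Properties
open import Data.Nat.Induction using (Acc; acc)
open import Data.Nat.Logarithm using (⌊log₂_⌋; ⌈log₂⌉-mono-≤; ⌈log₂2^n⌉≡n)
open import Data.Nat.Logarithm.Core using (⌊log2⌋)
open import Data.Nat.ListAction using (sum)
open import Data.Nat.Tactic.RingSolver using (solve-∀)
open import Data.Fin using (Fin; punchIn) renaming (zero to fzero)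
import Data.Fin as F
open import Data.Fin.Properties using (toℕ<n; punchInᵢ≢i)
open import Data.Bool using (true; false; if_then_else_)
open import Data.Maybe using (just; nothing)
open import Data.Product using (∃; _,_)
open import Data.List using ([]; _∷_; length; map; allFin)
open import Data.List.Properties using (length-tabulate; foldr-preservesᵇ)
open import Data.List.Relation.Unary.Any using (here; there)
open import Data.List.Relation.Unary.All using (universal)
open import Data.List.Relation.Unary.All.Properties using (map⁺)
open import Data.List.Membership.Propositional using (_∈_)
open import Data.List.Membership.Propositional.Properties using (∈-allFin; ∈-length)
open import Relation.Nullary using (yes; no; does; contradiction)
open import Relation.Binary.PropositionalEquality
  using (_≡_; refl; cong; subst; _≢_; ≢-sym)

n<2*suc⌊n/2⌋ : ∀ n → n < 2 * suc ⌊ n /2⌋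
n<2*suc⌊n/2⌋ zero          = s≤s z≤n
n<2*suc⌊n/2⌋ (suc zero)    = s≤s (s≤s z≤n)
n<2*suc⌊n/2⌋ (suc (suc n)) = begin-strict
  2 + n                   <⟨ +-monoʳ-< 2 (n<2*suc⌊n/2⌋ n) ⟩
  2 + 2 * suc ⌊ n /2⌋     ≡⟨ *-suc 2 (suc ⌊ n /2⌋) ⟨
  2 * suc (suc ⌊ n /2⌋)   ∎
  where open ≤-Reasoning

n<2^suc⌊log2⌋n : ∀ n (rec : Acc _<_ n) → n < 2 ^ suc (⌊log2⌋ n rec)
n<2^suc⌊log2⌋n zero          _        = s≤s z≤n
n<2^suc⌊log2⌋n (suc zero)    _        = s≤s (s≤s z≤n)
n<2^suc⌊log2⌋n (suc (suc n)) (acc rs) =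
  <-≤-trans (n<2*suc⌊n/2⌋ (2 + n)) (*-monoʳ-≤ 2 (n<2^suc⌊log2⌋n (suc ⌊ n /2⌋) _))

n<2^suc⌊log₂n⌋ : ∀ n → n < 2 ^ suc ⌊log₂ n ⌋
n<2^suc⌊log₂n⌋ n = n<2^suc⌊log2⌋n n _

3*m<2^[2+k] : ∀ {m k} → m < 2 ^ k → 3 * m < 2 ^ (2 + k)
3*m<2^[2+k] {m} {k} m<2^k = begin-strict
  3 * m       ≤⟨ *-monoˡ-≤ m (n≤1+n 3) ⟩
  4 * m       <⟨ *-monoʳ-< 4 m<2^k ⟩
  4 * 2 ^ k   ≡⟨ *-assoc 2 2 (2 ^ k) ⟩
  2 ^ (2 + k) ∎
  where open ≤-Reasoning

bitlen≤ : ∀ {x k} → x < 2 ^ k → bitlen x ≤ k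
bitlen≤ {k = k} x<2^k = ≤-trans (⌈log₂⌉-mono-≤ x<2^k) (≤-reflexive (⌈log₂2^n⌉≡n k))

maxOver≤ : ∀ {n} {f : Fin n → ℕ} {x} → (∀ w → f w ≤ x) → maxOver f ≤ x
maxOver≤ {x = x} f≤x =
  foldr-preservesᵇ {P = _≤ x} {f = _⊔_} ⊔-lub z≤n (map⁺ (universal f≤x (allFin _)))

module _ {A : Set} (f : A → ℕ) where

  ∈⇒≤sum-map : ∀ {x xs} → x ∈ xs → f x ≤ sum (map f xs)
  ∈⇒≤sum-map              (here refl)  = m≤m+n _ _
  ∈⇒≤sum-map {xs = y ∷ _} (there x∈xs) = ≤-trans (∈⇒≤sum-map x∈xs) (m≤n+m _ (f y))

  length≤sum-map : (∀ x → 0 < f x) → ∀ xs → length xs ≤ sum (map f xs)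
  length≤sum-map 0<f []       = z≤n
  length≤sum-map 0<f (x ∷ xs) = +-mono-≤ (0<f x) (length≤sum-map 0<f xs)

∃-≢ : ∀ {n} → 1 < n → (u : Fin n) → ∃ (u ≢_)
∃-≢ {suc zero}    (s≤s ()) _
∃-≢ {suc (suc _)} _        u = punchIn u fzero , ≢-sym (punchInᵢ≢i u fzero)

upd-preserves : ∀ {n} {A : Set} (P : Fin n → A → Set) {f : Fin n → A} {v x} →
                (∀ w → P w (f w)) → P v x → ∀ w → P w (upd f v x w)
upd-preserves P {v = v} Pf Px w with w F.≟ v
... | yes refl = Px
... | no  _    = Pf w

workSpace-arith : ∀ {n l a b c d e} → 0 < n → a ≤ 2 + suc l → b ≤ suc l →
                  c ≤ suc l → d ≤ suc l → e ≤ suc l →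
                  n * a + n * b + n + n + c + d + e ≤ 9 * n * suc l
workSpace-arith {suc n} {l} _ a≤ b≤ c≤ d≤ e≤ = begin
  _ ≤⟨ +-mono-≤ (+-mono-≤ (+-mono-≤ (+-monoˡ-≤ (suc n) (+-monoˡ-≤ (suc n)
         (+-mono-≤ (*-monoʳ-≤ (suc n) a≤) (*-monoʳ-≤ (suc n) b≤)))) c≤) d≤) e≤ ⟩
  _ ≤⟨ m≤m+n _ (3 * n + 4 * l + 7 * n * l) ⟩
  _ ≡⟨ expand n l ⟩
  9 * suc n * suc l ∎
  where
  open ≤-Reasoning
  expand : ∀ n l →
    suc n * (2 + suc l) + suc n * suc l + suc n + suc n + suc l + suc l + suc l
      + (3 * n + 4 * l + 7 * n * l) ≡ 9 * suc n * suc l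
  expand = solve-∀

module _ {n : ℕ} (G : Graph n) where
  open Graph G
  open State

  record Bounded (s : State n) : Set where
    field
      c≤edges : c s ≤ edges G
      next≤   : ∀ w → next s w ≤ 2 * c s + indeg G w
      B≤n     : ∀ w → B s w ≤ n
  open Bounded

  initState-bounded : ∀ v0 → Bounded (initState v0)
  initState-bounded v0 = record { c≤edges = z≤n ; next≤ = λ _ → z≤n ; B≤n = λ _ → z≤n }

  module _ (s : State n) (bd : Bounded s) where
    private
      u : Fin n
      u = cur s

    inEdge-bounded : suc (next s u) ≤ indeg G u → ∀ v →
      Bounded (record s { next = upd (next s) u (suc (next s u)) ; cur = v })
    inEdge-bounded nx≤d v = record
      { c≤edges = c≤edges bd
      ; next≤   = upd-preserves (λ w x → x ≤ 2 * c s + indeg G w) (next≤ bd)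
                    (≤-trans nx≤d (m≤n+m _ _))
      ; B≤n     = B≤n bd }

    discover-bounded : suc (next s u) ≤ indeg G u → ∀ v →
      Bounded (record s
        { next    = upd (next s) u (suc (next s u))
        ; B       = if does (v F.≟ v₀ s) then B s else upd (B s) v (encV u)
        ; visited = upd (visited s) v true
        ; cur     = v })
    discover-bounded nx≤d v = record
      { c≤edges = c≤edges bd
      ; next≤   = next≤ (inEdge-bounded nx≤d v)
      ; B≤n     = B≤n-discover (does (v F.≟ v₀ s)) }
      where
      B≤n-discover : ∀ b w → (if b then B s else upd (B s) v (encV u)) w ≤ n
      B≤n-discover true  = B≤n bd
      B≤n-discover false = upd-preserves (λ _ x → x ≤ n) (B≤n bd) (toℕ<n u)

    outEdge-bounded : c s < edges G → ∀ {j} → j ≤ 2 + next s u → ∀ skp v →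
      Bounded (record s { next = upd (next s) u j ; skipped = skp ; c = suc (c s) ; cur = v })
    outEdge-bounded c<m {j} j≤ skp v = record
      { c≤edges = c<m
      ; next≤   = upd-preserves (λ w x → x ≤ 2 * suc (c s) + indeg G w)
                    (λ w → ≤-trans (next≤ bd w) (+-monoˡ-≤ (indeg G w) (*-monoʳ-≤ 2 (n≤1+n _))))
                    next≤-exit
      ; B≤n     = B≤n bd }
      where
      open ≤-Reasoning
      next≤-exit : j ≤ 2 * suc (c s) + indeg G u
      next≤-exit = begin
        j                           ≤⟨ j≤ ⟩
        2 + next s u                ≤⟨ +-monoʳ-≤ 2 (next≤ bd u) ⟩
        2 + (2 * c s + indeg G u)   ≡⟨ cong (_+ indeg G u) (*-suc 2 (c s)) ⟨
        2 * suc (c s) + indeg G u   ∎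

  -- The case split replays the with-structure of step; the three exits without
  -- a skip reach the same call of its local moveOut, which cannot be named here,
  -- so each is unfolded separately.
  step-bounded : ∀ s {s′} → c s < edges G → Bounded s → step G s ≡ just s′ → Bounded s′
  step-bounded s c<m bd with suc (next s (cur s)) ≤? indeg G (cur s)
  ... | yes nx≤d with nth (ins (cur s)) (suc (next s (cur s)))
  ...   | nothing = λ ()
  ...   | just v with visited s v
  ...     | true  = λ { refl → inEdge-bounded s bd nx≤d v }
  ...     | false = λ { refl → discover-bounded s bd nx≤d v }
  step-bounded s c<m bd | no _ with nth (outs (cur s)) (suc (next s (cur s)) ∸ indeg G (cur s))
  ... | just w with does (encV w ≟ B s (cur s)) | skipped s (cur s)
  ...   | true | false with outdeg G (cur s) <? suc (suc (next s (cur s)) ∸ indeg G (cur s))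
  ...     | yes _ with decV {n} (B s (cur s))
  ...       | nothing = λ ()
  ...       | just v  = λ { refl → outEdge-bounded s bd c<m ≤-refl _ v }
  step-bounded s c<m bd | no _ | just w | true | false | no _
    with nth (outs (cur s)) (suc (suc (next s (cur s)) ∸ indeg G (cur s)))
  ...       | nothing = λ ()
  ...       | just v  = λ { refl → outEdge-bounded s bd c<m ≤-refl _ v }
  step-bounded s c<m bd | no _ | just w | true | true
    with outdeg G (cur s) <? suc (next s (cur s)) ∸ indeg G (cur s)
  ... | yes _ with decV {n} (B s (cur s))
  ...   | nothing = λ ()
  ...   | just v  = λ { refl → outEdge-bounded s bd c<m (n≤1+n _) _ v }
  step-bounded s c<m bd | no _ | just w | true | true | no _
    with nth (outs (cur s)) (suc (next s (cur s)) ∸ indeg G (cur s))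
  ...   | nothing = λ ()
  ...   | just v  = λ { refl → outEdge-bounded s bd c<m (n≤1+n _) _ v }
  step-bounded s c<m bd | no _ | just w | false | _
    with outdeg G (cur s) <? suc (next s (cur s)) ∸ indeg G (cur s)
  ... | yes _ with decV {n} (B s (cur s))
  ...   | nothing = λ ()
  ...   | just v  = λ { refl → outEdge-bounded s bd c<m (n≤1+n _) _ v }
  step-bounded s c<m bd | no _ | just w | false | _ | no _
    with nth (outs (cur s)) (suc (next s (cur s)) ∸ indeg G (cur s))
  ...   | nothing = λ ()
  ...   | just v  = λ { refl → outEdge-bounded s bd c<m (n≤1+n _) _ v }
  step-bounded s c<m bd | no _ | nothing
    with outdeg G (cur s) <? suc (next s (cur s)) ∸ indeg G (cur s)
  ... | yes _ with decV {n} (B s (cur s))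
  ...   | nothing = λ ()
  ...   | just v  = λ { refl → outEdge-bounded s bd c<m (n≤1+n _) _ v }
  step-bounded s c<m bd | no _ | nothing | no _
    with nth (outs (cur s)) (suc (next s (cur s)) ∸ indeg G (cur s))
  ...   | nothing = λ ()
  ...   | just v  = λ { refl → outEdge-bounded s bd c<m (n≤1+n _) _ v }

  run-bounded : ∀ v0 k {s} → run G v0 k ≡ just s → Bounded s
  run-bounded v0 zero    refl = initState-bounded v0
  run-bounded v0 (suc k) with run G v0 k in run≡s₀
  ... | nothing = λ ()
  ... | just s₀ with c s₀ <? edges G
  ...   | yes c<m = step-bounded s₀ c<m (run-bounded v0 k run≡s₀)
  ...   | no  _   = λ { refl → run-bounded v0 k run≡s₀ }

  outdeg≤edges : ∀ w → outdeg G w ≤ edges G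
  outdeg≤edges w = ∈⇒≤sum-map (outdeg G) (∈-allFin w)

  Reach⇒0<outdeg : ∀ {u v} → Reach G u v → u ≢ v → 0 < outdeg G u
  Reach⇒0<outdeg here          u≢u = contradiction refl u≢u
  Reach⇒0<outdeg (there w∈ _) _   = ∈-length w∈

  vertices≤edges : StronglyConnected G → 1 < n → n ≤ edges G
  vertices≤edges sc 1<n = subst (_≤ edges G) (length-tabulate (λ w → w))
    (length≤sum-map (outdeg G) 0<outdeg (allFin n))
    where
    0<outdeg : ∀ u → 0 < outdeg G u
    0<outdeg u with ∃-≢ 1<n u
    ... | v , u≢v = Reach⇒0<outdeg (sc u v) u≢v

  vertices<2^suc⌊log₂edges⌋ : StronglyConnected G → n < 2 ^ suc ⌊log₂ edges G ⌋
  vertices<2^suc⌊log₂edges⌋ sc with 1 <? n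
  ... | yes 1<n = ≤-<-trans (vertices≤edges sc 1<n) (n<2^suc⌊log₂n⌋ (edges G))
  ... | no  1≮n = ≤-<-trans (≮⇒≥ 1≮n) (*-monoʳ-≤ 2 (m^n>0 2 ⌊log₂ edges G ⌋))

  workSpace≤ : Eulerian G → ∀ s → Bounded s → workSpace s ≤ 9 * n * suc ⌊log₂ edges G ⌋
  workSpace≤ (sc , out≡in) s bd = workSpace-arith (≤-<-trans z≤n (toℕ<n (cur s)))
    (bitlen≤ (≤-<-trans (maxOver≤ next≤3m) (3*m<2^[2+k] {k = suc ⌊log₂ edges G ⌋} m<2^L)))
    (bitlen≤ (≤-<-trans (maxOver≤ (B≤n bd)) n<2^L))
    (bitlen≤ (≤-<-trans (c≤edges bd) m<2^L))
    (bitlen≤ (≤-<-trans (toℕ<n (cur s)) n<2^L))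
    (bitlen≤ (≤-<-trans (toℕ<n (v₀ s)) n<2^L))
    where
    m<2^L : edges G < 2 ^ suc ⌊log₂ edges G ⌋
    m<2^L = n<2^suc⌊log₂n⌋ (edges G)
    n<2^L : n < 2 ^ suc ⌊log₂ edges G ⌋
    n<2^L = vertices<2^suc⌊log₂edges⌋ sc
    next≤3m : ∀ w → next s w ≤ 3 * edges G
    next≤3m w = begin
      next s w                 ≤⟨ next≤ bd w ⟩
      2 * c s + indeg G w      ≤⟨ +-mono-≤ (*-monoʳ-≤ 2 (c≤edges bd))
                                    (subst (_≤ edges G) (out≡in w) (outdeg≤edges w)) ⟩
      2 * edges G + edges G    ≡⟨ +-comm (2 * edges G) (edges G) ⟩
      3 * edges G              ∎
      where open ≤-Reasoning

theorem13 : ∃ λ (K : ℕ) → ∀ (n : ℕ) (G : Graph n) → Eulerian G →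
            ∀ (v0 : Fin n) (k : ℕ) (s : State n) → run G v0 k ≡ just s →
            workSpace s ≤ K * n * suc ⌊log₂ edges G ⌋
theorem13 = 9 , λ n G eulerian v0 k s run≡s → workSpace≤ G eulerian s (run-bounded G v0 k run≡s)
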